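{- The underlying graph $G$ of the order-$7$ triangular tiling of the hyperbolic plane does not have a polynomial containment property, i.e. for no $d\ge 0$ does $G$ have the $O(n^d)$-containment property.
   Context: The order-$7$ triangular tiling is the tiling of the hyperbolic plane by congruent regular triangles with exactly seven triangles meeting at each vertex (Schläfli symbol $\{3,7\}$); its underlying graph has the tiling's vertices and edges. Given a finite set $X_0$ of vertices, a sequence $\{W_k\}_{k\geq1}$ of vertex sets is an $\{f_n\}$-containment strategy for $X_0$ if: (1) $|W_n|\le f_n$ for all $n\ge1$; (2) $X_n\cap W_{n+1}=\emptyset$ for all $n\ge0$, where for $n>0$, $X_n$ is the set of vertices connected to a vertex of $X_{n-1}$ by a path of length at most $1$ containing no vertex of $W_1\cup\cdots\cup W_n$; (3) there is $N>0$ with $X_n=X_N$ for all $n\ge N$. $G$ has the $\{f_n\}$-containment property if every finite vertex set admits such a strategy; it has the $O(n^d)$-containment property if it has the $\{f_n\}$-containment property for some non-negative integer sequence with $f_n=O(n^d)$. -}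

module Defs where

open import Data.Nat using (ℕ; zero; suc; _+_; _*_; _^_; _≤_)
open import Data.Fin using (Fin; toℕ)
open import Data.Bool using (Bool; true; false)
open import Data.List using (List; []; _∷_; length; lookup; take; map; concatMap; replicate)
open import Data.Nat.ListAction using (sum)
open import Data.List.Membership.Propositional using (_∈_)
open import Data.Product using (Σ; ∃; ∃₂; _×_; _,_)
open import Data.Sum using (_⊎_)
open import Relation.Nullary using (¬_)
open import Relation.Binary.PropositionalEquality using (_≡_)

-- The order-7 triangular tiling {3,7}, built layer by layer around a
-- fixed vertex (the root, layer 0).  Layer k ≥ 1 is a cycle of vertices,
-- each tagged  true  ("B": exactly one neighbour in layer k-1) or
-- false ("A": exactly two neighbours in layer k-1).
-- Listing layer k+1 in cyclic order, a vertex x of layer k contributes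
-- its private children followed by the child shared with the next
-- vertex of layer k (the apex of the outward triangle on that edge):
--   B ↦ B B A   (B has 4 children: 2 private, 2 shared)
--   A ↦ B A     (A has 3 children: 1 private, 2 shared)
-- Every vertex then has degree 7 and every face is a triangle.

block : Bool → List Bool
block true  = true ∷ true ∷ false ∷ []
block false = true ∷ false ∷ []

layer : ℕ → List Bool
layer zero = true ∷ []
layer (suc zero) = replicate 7 true
layer (suc (suc k)) = concatMap block (layer (suc k))

Vertex : Set
Vertex = Σ ℕ λ k → Fin (length (layer k))

blen : Bool → ℕ
blen b = length (block b)

-- position in layer k+1 where the block of the i-th vertex of layer k starts
start : ℕ → ℕ → ℕ
start k i = sum (map blen (take i (layer k)))

SuccCyc : ℕ → ℕ → ℕ → Set
SuccCyc L a b = (b ≡ suc a) ⊎ ((suc a ≡ L) × (b ≡ 0))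

ChildPos : ℕ → ℕ → ℕ → Set
ChildPos L s b = (suc b ≡ s) ⊎ ((s ≡ 0) × (suc b ≡ L))

data Step : Vertex → Vertex → Set where
  centre : (i : Fin (length (layer 0))) (j : Fin (length (layer 1))) →
           Step (0 , i) (1 , j)
  around : (k : ℕ) (i j : Fin (length (layer (suc k)))) →
           SuccCyc (length (layer (suc k))) (toℕ i) (toℕ j) →
           Step (suc k , i) (suc k , j)
  -- the children of the i-th vertex of layer k+1 are the positions
  -- start-1, start, ..., start+blen-1 (cyclically) of layer k+2
  down   : (k : ℕ) (i : Fin (length (layer (suc k))))
           (j : Fin (length (layer (suc (suc k))))) (t : ℕ) →
           t ≤ blen (lookup (layer (suc k)) i) →
           ChildPos (length (layer (suc (suc k)))) (start (suc k) (toℕ i) + t) (toℕ j) →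
           Step (suc k , i) (suc (suc k) , j)

Adj : Vertex → Vertex → Set
Adj u v = Step u v ⊎ Step v u

-- Containment.  A strategy is a sequence n ↦ W n (only n ≥ 1 is used)
-- of finite vertex sets, given as lists.

Strategy : Set
Strategy = ℕ → List Vertex

Blocked : Strategy → ℕ → Vertex → Set
Blocked W n v = ∃ λ m → (1 ≤ m) × (m ≤ n) × (v ∈ W m)

Reach : Strategy → List Vertex → ℕ → Vertex → Set
Reach W X0 zero v = v ∈ X0
Reach W X0 (suc n) v =
  ∃ λ u → Reach W X0 n u × ((u ≡ v) ⊎ Adj u v)
        × ¬ Blocked W (suc n) u × ¬ Blocked W (suc n) v

IsContainmentStrategy : (ℕ → ℕ) → List Vertex → Strategy → Set
IsContainmentStrategy f X0 W =
  (∀ n → 1 ≤ n → length (W n) ≤ f n)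
  × (∀ n v → Reach W X0 n v → ¬ (v ∈ W (suc n)))
  × (∃ λ N → (1 ≤ N) × (∀ n → N ≤ n → ∀ v →
        (Reach W X0 n v → Reach W X0 N v) × (Reach W X0 N v → Reach W X0 n v)))

HasContainment : (ℕ → ℕ) → Set
HasContainment f = ∀ (X0 : List Vertex) → ∃ λ W → IsContainmentStrategy f X0 W

BigO : (ℕ → ℕ) → ℕ → Set
BigO f d = ∃₂ λ C n0 → ∀ n → n0 ≤ n → f n ≤ C * n ^ d

HasPolyContainment : ℕ → Set
HasPolyContainment d = ∃ λ (f : ℕ → ℕ) → BigO f d × HasContainment f

-- Light the whole layer M + 1 and follow only the part of the fire that moves outward, one
-- layer per step.  Give a vertex weight 2 if it has one neighbour in the previous layer and 1
-- if it has two.  The outward neighbours of a weight-2 vertex weigh 5 and those of a weight-1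
-- vertex weigh 3, so the outward front multiplies its weight by at least 5/2 per step, while
-- each vertex protected so far takes away at most 2.  With O(n^d) firefighters per step at
-- most K 2^n vertices are protected by time n, so for M = 8K + 1 the front keeps weight at
-- least 2^n M: it never dies out, the fire enters a new layer at every step, and the burning
-- set never stabilises.
module Submission where

open import Defs
open import Data.Bool using (Bool; true; false)
open import Data.Fin as Fin using (Fin; zero; suc; toℕ)
import Data.Fin.Properties as Finₚ
open import Data.List using (List; []; _∷_; _++_; length; lookup; take; map; concatMap; allFin; filter)
open import Data.List.Properties using (length-++; length-map; length-tabulate; map-++; map-∘; map-cong)
open import Data.List.Membership.Propositional using (_∈_; find)
open import Data.List.Membership.Propositional.Properties
  using (∈-map⁺; ∈-map⁻; ∈-++⁺ˡ; ∈-++⁺ʳ; ∈-++⁻; ∈-∃++; ∈-allFin; ∈-filter⁻; ∈-concatMap⁻)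
open import Data.List.Relation.Binary.Disjoint.Propositional using (Disjoint)
open import Data.List.Relation.Binary.Subset.Propositional using (_⊆_)
open import Data.List.Relation.Unary.Any using (here; there)
import Data.List.Relation.Unary.All as All
import Data.List.Relation.Unary.All.Properties as Allₚ
open import Data.List.Relation.Unary.AllPairs as AllPairs using (_∷_)
import Data.List.Relation.Unary.AllPairs.Properties as AllPairsₚ
open import Data.List.Relation.Unary.Unique.Propositional using (Unique)
import Data.List.Relation.Unary.Unique.Propositional.Properties as Unique
open import Data.Nat
open import Data.Nat.DivMod using (_/_; _%_; m≡m%n+[m/n]*n; m%n<n; m/n*n≤m)
open import Data.Nat.ListAction using (sum)
open import Data.Nat.ListAction.Properties using (sum-++)
open import Data.Nat.Properties
open import Data.Nat.Solver using (module +-*-Solver)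
open +-*-Solver using (solve; _:+_; _:*_; _:=_; con)
open import Data.Product using (∃; _×_; _,_; proj₁; proj₂)
open import Data.Product.Properties using (≡-dec)
open import Data.Sum using (inj₁; inj₂)
open import Data.Empty using (⊥-elim)
open import Function using (_∘_; id)
open import Relation.Nullary using (¬_; Dec; yes; no)
open import Relation.Unary using (Decidable)
open import Relation.Unary.Properties using (∁?)
open import Relation.Binary.PropositionalEquality

^-distribʳ-* : ∀ m n o → (m * n) ^ o ≡ m ^ o * n ^ o
^-distribʳ-* m n zero    = refl
^-distribʳ-* m n (suc o) = begin
  m * n * (m * n) ^ o      ≡⟨ cong (m * n *_) (^-distribʳ-* m n o) ⟩
  m * n * (m ^ o * n ^ o)  ≡⟨ [m*n]*[o*p]≡[m*o]*[n*p] m n (m ^ o) (n ^ o) ⟩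
  m * m ^ o * (n * n ^ o)  ∎
  where open ≡-Reasoning

n<2^n : ∀ n → n < 2 ^ n
n<2^n zero    = s≤s z≤n
n<2^n (suc n) = +-mono-≤ (m^n>0 2 n) (≤-trans (n<2^n n) (≤-reflexive (sym (+-identityʳ (2 ^ n)))))

-- Write n = q e + r with r < e; then n ≤ (q + 1) e and (q + 1)^e ≤ 2^(q e) ≤ 2^n.
n^e≤e^e*2^n : ∀ e .{{_ : NonZero e}} n → n ^ e ≤ e ^ e * 2 ^ n
n^e≤e^e*2^n e n = begin
  n ^ e                    ≤⟨ ^-monoˡ-≤ e n≤[1+q]*e ⟩
  (suc q * e) ^ e          ≡⟨ ^-distribʳ-* (suc q) e e ⟩
  suc q ^ e * e ^ e        ≤⟨ *-monoˡ-≤ (e ^ e) (^-monoˡ-≤ e (n<2^n q)) ⟩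
  (2 ^ q) ^ e * e ^ e      ≡⟨ cong (_* e ^ e) (^-*-assoc 2 q e) ⟩
  2 ^ (q * e) * e ^ e      ≤⟨ *-monoˡ-≤ (e ^ e) (^-monoʳ-≤ 2 (m/n*n≤m n e)) ⟩
  2 ^ n * e ^ e            ≡⟨ *-comm (2 ^ n) (e ^ e) ⟩
  e ^ e * 2 ^ n            ∎
  where
  open ≤-Reasoning
  q = n / e
  n≤[1+q]*e : n ≤ suc q * e
  n≤[1+q]*e = begin
    n              ≡⟨ m≡m%n+[m/n]*n n e ⟩
    n % e + q * e  ≤⟨ +-monoˡ-≤ (q * e) (<⇒≤ (m%n<n n e)) ⟩
    e + q * e      ∎

5c≤2a+4b⇒2c≤a : ∀ {a b c} → 5 * c ≤ 2 * a + 4 * b → 4 * b ≤ c → 2 * c ≤ a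
5c≤2a+4b⇒2c≤a {a} {b} {c} 5c≤ 4b≤c = *-cancelˡ-≤ 2 (+-cancelʳ-≤ c (2 * (2 * c)) (2 * a) (begin
  2 * (2 * c) + c  ≡⟨ solve 1 (λ c → con 2 :* (con 2 :* c) :+ c := con 5 :* c) refl c ⟩
  5 * c            ≤⟨ 5c≤ ⟩
  2 * a + 4 * b    ≤⟨ +-monoʳ-≤ (2 * a) 4b≤c ⟩
  2 * a + c        ∎))
  where open ≤-Reasoning

partialSum : (ℕ → ℕ) → ℕ → ℕ
partialSum f zero    = 0
partialSum f (suc n) = f (suc n) + partialSum f n

partialSum-mono-≤ : ∀ f {m n} → m ≤ n → partialSum f m ≤ partialSum f n
partialSum-mono-≤ f {n = zero}  z≤n = ≤-refl
partialSum-mono-≤ f {n = suc n} m≤1+n with m≤n⇒m<n∨m≡n m≤1+n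
... | inj₁ (s≤s m≤n) = ≤-trans (partialSum-mono-≤ f m≤n) (m≤n+m (partialSum f n) (f (suc n)))
... | inj₂ refl      = ≤-refl

partialSum-≤-poly : ∀ f d C n₀ → (∀ n → n₀ ≤ n → f n ≤ C * n ^ d) →
                    ∀ n → partialSum f n ≤ partialSum f n₀ + C * n ^ suc d
partialSum-≤-poly f d C n₀ f≤ zero    = z≤n
partialSum-≤-poly f d C n₀ f≤ (suc n) with suc n ≤? n₀
... | yes 1+n≤n₀ = ≤-trans (partialSum-mono-≤ f 1+n≤n₀) (m≤m+n (partialSum f n₀) _)
... | no 1+n≰n₀  = begin
  f (suc n) + partialSum f n                     ≤⟨ +-mono-≤ (f≤ (suc n) (<⇒≤ (≰⇒> 1+n≰n₀)))
                                                               (partialSum-≤-poly f d C n₀ f≤ n) ⟩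
  C * x + (A + C * (n * n ^ d))                  ≤⟨ +-monoʳ-≤ (C * x) (+-monoʳ-≤ A
                                                      (*-monoʳ-≤ C (*-monoʳ-≤ n (^-monoˡ-≤ d (n≤1+n n))))) ⟩
  C * x + (A + C * (n * x))                      ≡⟨ regroup ⟩
  A + C * (suc n * x)                            ∎
  where
  open ≤-Reasoning
  A = partialSum f n₀
  x = suc n ^ d
  regroup : C * x + (A + C * (n * x)) ≡ A + C * (suc n * x)
  regroup = solve 4 (λ C A n x → C :* x :+ (A :+ C :* (n :* x)) := A :+ C :* ((con 1 :+ n) :* x))
                  refl C A n x

partialSum-≤-exponential : ∀ f d → BigO f d → ∃ λ K → ∀ n → partialSum f n ≤ K * 2 ^ n
partialSum-≤-exponential f d (C , n₀ , f≤) = A + C * E , λ n → begin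
  partialSum f n                 ≤⟨ partialSum-≤-poly f d C n₀ f≤ n ⟩
  A + C * n ^ suc d              ≤⟨ +-mono-≤ (m≤m*n A (2 ^ n) {{m^n≢0 2 n}})
                                             (*-monoʳ-≤ C (n^e≤e^e*2^n (suc d) n)) ⟩
  A * 2 ^ n + C * (E * 2 ^ n)    ≡⟨ cong (A * 2 ^ n +_) (sym (*-assoc C E (2 ^ n))) ⟩
  A * 2 ^ n + C * E * 2 ^ n      ≡⟨ sym (*-distribʳ-+ (2 ^ n) A (C * E)) ⟩
  (A + C * E) * 2 ^ n            ∎
  where
  open ≤-Reasoning
  A = partialSum f n₀
  E = suc d ^ suc d

module _ {A : Set} where

  Unique-⊆⇒length-≤ : {xs ys : List A} → Unique xs → xs ⊆ ys → length xs ≤ length ys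
  Unique-⊆⇒length-≤ {[]}     _          _  = z≤n
  Unique-⊆⇒length-≤ {x ∷ xs} (x∉xs ∷ u) xs⊆ys with ∈-∃++ (xs⊆ys (here refl))
  ... | as , bs , refl = begin
    suc (length xs)              ≤⟨ s≤s (Unique-⊆⇒length-≤ u xs⊆as++bs) ⟩
    suc (length (as ++ bs))      ≡⟨ cong suc (length-++ as) ⟩
    suc (length as + length bs)  ≡⟨ sym (+-suc (length as) (length bs)) ⟩
    length as + suc (length bs)  ≡⟨ sym (length-++ as) ⟩
    length (as ++ x ∷ bs)        ∎
    where
    open ≤-Reasoning
    xs⊆as++bs : xs ⊆ as ++ bs
    xs⊆as++bs y∈xs with ∈-++⁻ as (xs⊆ys (there y∈xs))
    ... | inj₁ y∈as         = ∈-++⁺ˡ y∈as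
    ... | inj₂ (here y≡x)   = ⊥-elim (All.lookup x∉xs y∈xs (sym y≡x))
    ... | inj₂ (there y∈bs) = ∈-++⁺ʳ as y∈bs

  sum-map-filter-≤ : ∀ {P : A → Set} (P? : Decidable P) (w : A → ℕ) {c} → (∀ x → w x ≤ c) →
                     ∀ xs → sum (map w xs) ≤ sum (map w (filter (∁? P?) xs)) + c * length (filter P? xs)
  sum-map-filter-≤ P? w w≤c []       = z≤n
  sum-map-filter-≤ P? w {c} w≤c (x ∷ xs) with P? x
  ... | yes _ = begin
    w x + sum (map w xs)            ≤⟨ +-mono-≤ (w≤c x) (sum-map-filter-≤ P? w w≤c xs) ⟩
    c + (kept + c * length dropped)  ≡⟨ solve 3 (λ c k l → c :+ (k :+ c :* l) := k :+ c :* (con 1 :+ l))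
                                               refl c kept (length dropped) ⟩
    kept + c * suc (length dropped)  ∎
    where
    open ≤-Reasoning
    kept = sum (map w (filter (∁? P?) xs))
    dropped = filter P? xs
  ... | no _ = ≤-trans (+-monoʳ-≤ (w x) (sum-map-filter-≤ P? w w≤c xs))
                       (≤-reflexive (sym (+-assoc (w x) _ _)))

module _ {B : Set} where

  indexˡ : (xs ys : List B) → Fin (length xs) → Fin (length (xs ++ ys))
  indexˡ (x ∷ xs) ys zero    = zero
  indexˡ (x ∷ xs) ys (suc i) = suc (indexˡ xs ys i)

  indexʳ : (xs ys : List B) → Fin (length ys) → Fin (length (xs ++ ys))
  indexʳ []       ys j = j
  indexʳ (x ∷ xs) ys j = suc (indexʳ xs ys j)

  lookup-indexˡ : ∀ xs ys i → lookup (xs ++ ys) (indexˡ xs ys i) ≡ lookup xs i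
  lookup-indexˡ (x ∷ xs) ys zero    = refl
  lookup-indexˡ (x ∷ xs) ys (suc i) = lookup-indexˡ xs ys i

  lookup-indexʳ : ∀ xs ys j → lookup (xs ++ ys) (indexʳ xs ys j) ≡ lookup ys j
  lookup-indexʳ []       ys j = refl
  lookup-indexʳ (x ∷ xs) ys j = lookup-indexʳ xs ys j

  toℕ-indexˡ : ∀ xs ys i → toℕ (indexˡ xs ys i) ≡ toℕ i
  toℕ-indexˡ (x ∷ xs) ys zero    = refl
  toℕ-indexˡ (x ∷ xs) ys (suc i) = cong suc (toℕ-indexˡ xs ys i)

  toℕ-indexʳ : ∀ xs ys j → toℕ (indexʳ xs ys j) ≡ length xs + toℕ j
  toℕ-indexʳ []       ys j = refl
  toℕ-indexʳ (x ∷ xs) ys j = cong suc (toℕ-indexʳ xs ys j)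

  indexˡ-injective : ∀ xs ys {i i′} → indexˡ xs ys i ≡ indexˡ xs ys i′ → i ≡ i′
  indexˡ-injective (x ∷ xs) ys {zero}  {zero}   _ = refl
  indexˡ-injective (x ∷ xs) ys {suc i} {suc i′} e = cong suc (indexˡ-injective xs ys (Finₚ.suc-injective e))

  indexʳ-injective : ∀ xs ys {j j′} → indexʳ xs ys j ≡ indexʳ xs ys j′ → j ≡ j′
  indexʳ-injective []       ys e = e
  indexʳ-injective (x ∷ xs) ys e = indexʳ-injective xs ys (Finₚ.suc-injective e)

  indexˡ≢indexʳ : ∀ xs ys i j → indexˡ xs ys i ≢ indexʳ xs ys j
  indexˡ≢indexʳ (x ∷ xs) ys zero    j ()
  indexˡ≢indexʳ (x ∷ xs) ys (suc i) j e = indexˡ≢indexʳ xs ys i j (Finₚ.suc-injective e)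

module ConcatMapPositions {A B : Set} (g : A → List B) where

  offset : List A → ℕ → ℕ
  offset xs i = sum (map (λ a → length (g a)) (take i xs))

  position : (xs : List A) (i : Fin (length xs)) →
             Fin (length (g (lookup xs i))) → Fin (length (concatMap g xs))
  position (x ∷ xs) zero    t = indexˡ (g x) (concatMap g xs) t
  position (x ∷ xs) (suc i) t = indexʳ (g x) (concatMap g xs) (position xs i t)

  lookup-position : ∀ xs i t → lookup (concatMap g xs) (position xs i t) ≡ lookup (g (lookup xs i)) t
  lookup-position (x ∷ xs) zero    t = lookup-indexˡ (g x) (concatMap g xs) t
  lookup-position (x ∷ xs) (suc i) t =
    trans (lookup-indexʳ (g x) (concatMap g xs) (position xs i t)) (lookup-position xs i t)

  toℕ-position : ∀ xs i t → toℕ (position xs i t) ≡ offset xs (toℕ i) + toℕ t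
  toℕ-position (x ∷ xs) zero    t = toℕ-indexˡ (g x) (concatMap g xs) t
  toℕ-position (x ∷ xs) (suc i) t = begin
    toℕ (indexʳ (g x) (concatMap g xs) (position xs i t))  ≡⟨ toℕ-indexʳ (g x) (concatMap g xs) (position xs i t) ⟩
    length (g x) + toℕ (position xs i t)                   ≡⟨ cong (length (g x) +_) (toℕ-position xs i t) ⟩
    length (g x) + (offset xs (toℕ i) + toℕ t)             ≡⟨ sym (+-assoc (length (g x)) _ _) ⟩
    length (g x) + offset xs (toℕ i) + toℕ t               ∎
    where open ≡-Reasoning

  position-injectiveˡ : ∀ xs {i i′ t t′} → position xs i t ≡ position xs i′ t′ → i ≡ i′
  position-injectiveˡ (x ∷ xs) {zero}  {zero}   _ = refl
  position-injectiveˡ (x ∷ xs) {zero}  {suc i′} e = ⊥-elim (indexˡ≢indexʳ (g x) (concatMap g xs) _ _ e)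
  position-injectiveˡ (x ∷ xs) {suc i} {zero}   e = ⊥-elim (indexˡ≢indexʳ (g x) (concatMap g xs) _ _ (sym e))
  position-injectiveˡ (x ∷ xs) {suc i} {suc i′} e =
    cong suc (position-injectiveˡ xs (indexʳ-injective (g x) (concatMap g xs) e))

  position-injectiveʳ : ∀ xs i {t t′} → position xs i t ≡ position xs i t′ → t ≡ t′
  position-injectiveʳ (x ∷ xs) zero    e = indexˡ-injective (g x) (concatMap g xs) e
  position-injectiveʳ (x ∷ xs) (suc i) e = position-injectiveʳ xs i (indexʳ-injective (g x) (concatMap g xs) e)

  children : (xs : List A) → Fin (length xs) → List (Fin (length (concatMap g xs)))
  children xs i = map (position xs i) (allFin _)

  ∈-children⁻ : ∀ xs i {j} → j ∈ children xs i → ∃ λ t → j ≡ position xs i t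
  ∈-children⁻ xs i j∈ with ∈-map⁻ (position xs i) j∈
  ... | t , _ , j≡ = t , j≡

  ∈-concatMap-children⁻ : ∀ xs {F j} → j ∈ concatMap (children xs) F →
                          ∃ λ i → i ∈ F × ∃ λ t → j ≡ position xs i t
  ∈-concatMap-children⁻ xs j∈ with find (∈-concatMap⁻ (children xs) j∈)
  ... | i , i∈F , j∈children = i , i∈F , ∈-children⁻ xs i j∈children

  map-lookup-children : ∀ xs i →
    map (lookup (concatMap g xs)) (children xs i) ≡ map (lookup (g (lookup xs i))) (allFin _)
  map-lookup-children xs i = trans (sym (map-∘ (allFin _))) (map-cong (lookup-position xs i) (allFin _))

  children-Unique : ∀ xs i → Unique (children xs i)
  children-Unique xs i = Unique.map⁺ (position-injectiveʳ xs i) (Unique.allFin⁺ _)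

  children-disjoint : ∀ xs {i i′} → i ≢ i′ → Disjoint (children xs i) (children xs i′)
  children-disjoint xs i≢i′ (j∈ , j∈′) with ∈-children⁻ xs _ j∈ | ∈-children⁻ xs _ j∈′
  ... | _ , refl | _ , e = i≢i′ (position-injectiveˡ xs e)

  concatMap-children-Unique : ∀ xs {F} → Unique F → Unique (concatMap (children xs) F)
  concatMap-children-Unique xs uF =
    Unique.concat⁺ (Allₚ.map⁺ (All.tabulate (λ _ → children-Unique xs _)))
                   (AllPairsₚ.map⁺ (AllPairs.map (children-disjoint xs) uF))

size : ℕ → ℕ
size k = length (layer k)

length-concatMap-block : ∀ bs → length bs + length bs ≤ length (concatMap block bs)
length-concatMap-block []           = z≤n
length-concatMap-block (true ∷ bs)  = s≤s (≤-trans (≤-reflexive (+-suc (length bs) (length bs)))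
                                        (s≤s (≤-trans (length-concatMap-block bs) (n≤1+n _))))
length-concatMap-block (false ∷ bs) = s≤s (≤-trans (≤-reflexive (+-suc (length bs) (length bs)))
                                        (s≤s (length-concatMap-block bs)))

k<size[1+k] : ∀ k → k < size (suc k)
k<size[1+k] zero    = s≤s z≤n
k<size[1+k] (suc k) = begin
  suc (suc k)                  ≡⟨ +-comm 1 (suc k) ⟩
  suc k + 1                    ≤⟨ +-mono-≤ (k<size[1+k] k) (≤-trans (s≤s z≤n) (k<size[1+k] k)) ⟩
  size (suc k) + size (suc k)  ≤⟨ length-concatMap-block (layer (suc k)) ⟩
  size (suc (suc k))           ∎
  where open ≤-Reasoning

Adj⇒layer≤1+layer : ∀ {u v} → Adj u v → proj₁ v ≤ suc (proj₁ u)
Adj⇒layer≤1+layer (inj₁ (centre _ _))         = ≤-refl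
Adj⇒layer≤1+layer (inj₁ (around _ _ _ _))     = n≤1+n _
Adj⇒layer≤1+layer (inj₁ (down _ _ _ _ _ _))   = ≤-refl
Adj⇒layer≤1+layer (inj₂ (centre _ _))         = z≤n
Adj⇒layer≤1+layer (inj₂ (around _ _ _ _))     = n≤1+n _
Adj⇒layer≤1+layer (inj₂ (down _ _ _ _ _ _))   = ≤-trans (n≤1+n _) (n≤1+n _)

weight : Bool → ℕ
weight true  = 2
weight false = 1

potential : (k : ℕ) → List (Fin (size k)) → ℕ
potential k js = sum (map (weight ∘ lookup (layer k)) js)

potential-++ : ∀ k js js′ → potential k (js ++ js′) ≡ potential k js + potential k js′
potential-++ k js js′ = trans (cong sum (map-++ _ js js′)) (sum-++ (map _ js) (map _ js′))

length≤potential : ∀ k js → length js ≤ potential k js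
length≤potential k []       = z≤n
length≤potential k (j ∷ js) = +-mono-≤ (1≤weight (lookup (layer k) j)) (length≤potential k js)
  where
  1≤weight : ∀ b → 1 ≤ weight b
  1≤weight true  = s≤s z≤n
  1≤weight false = s≤s z≤n

open ConcatMapPositions block

offspring : (k : ℕ) → Fin (size (suc k)) → List (Fin (size (suc (suc k))))
offspring k = children (layer (suc k))

potential-offspring : ∀ k i →
  5 * weight (lookup (layer (suc k)) i) ≤ 2 * potential (suc (suc k)) (offspring k i)
potential-offspring k i = begin
  5 * weight b                                              ≤⟨ 5*weight≤2*weight-block b ⟩
  2 * sum (map weight (map (lookup (block b)) (allFin _)))   ≡⟨ cong (λ bs → 2 * sum (map weight bs))
                                                                  (sym (map-lookup-children (layer (suc k)) i)) ⟩
  2 * sum (map weight (map (lookup (layer (suc (suc k)))) (offspring k i)))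
                                                            ≡⟨ cong (λ ws → 2 * sum ws) (sym (map-∘ (offspring k i))) ⟩
  2 * potential (suc (suc k)) (offspring k i)               ∎
  where
  open ≤-Reasoning
  b = lookup (layer (suc k)) i
  5*weight≤2*weight-block : ∀ b → 5 * weight b ≤ 2 * sum (map weight (map (lookup (block b)) (allFin _)))
  5*weight≤2*weight-block true  = ≤-refl
  5*weight≤2*weight-block false = n≤1+n 5

potential-concatMap-offspring : ∀ k F →
  5 * potential (suc k) F ≤ 2 * potential (suc (suc k)) (concatMap (offspring k) F)
potential-concatMap-offspring k []      = z≤n
potential-concatMap-offspring k (i ∷ F) = begin
  5 * (w + potential (suc k) F)      ≡⟨ *-distribˡ-+ 5 w _ ⟩
  5 * w + 5 * potential (suc k) F    ≤⟨ +-mono-≤ (potential-offspring k i) (potential-concatMap-offspring k F) ⟩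
  2 * Φ (offspring k i) + 2 * Φ rest ≡⟨ sym (*-distribˡ-+ 2 (Φ (offspring k i)) (Φ rest)) ⟩
  2 * (Φ (offspring k i) + Φ rest)   ≡⟨ cong (2 *_) (sym (potential-++ (suc (suc k)) (offspring k i) rest)) ⟩
  2 * Φ (offspring k i ++ rest)      ∎
  where
  open ≤-Reasoning
  w = weight (lookup (layer (suc k)) i)
  Φ = potential (suc (suc k))
  rest = concatMap (offspring k) F

_≟ⱽ_ : (u v : Vertex) → Dec (u ≡ v)
_≟ⱽ_ = ≡-dec _≟_ Fin._≟_

open import Data.List.Membership.DecPropositional _≟ⱽ_ using (_∈?_)

vertex : ∀ k → Fin (size k) → Vertex
vertex k j = k , j

unblocked : ∀ k → List Vertex → List (Fin (size k)) → List (Fin (size k))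
unblocked k Bl = filter (∁? (λ j → vertex k j ∈? Bl))

potential-unblocked : ∀ k Bl js → Unique js →
                      potential k js ≤ potential k (unblocked k Bl js) + 2 * length Bl
potential-unblocked k Bl js u =
  ≤-trans (sum-map-filter-≤ blocked? (weight ∘ lookup (layer k)) (weight≤2 ∘ lookup (layer k)) js)
          (+-monoʳ-≤ (potential k (unblocked k Bl js)) (*-monoʳ-≤ 2 (begin
    length (filter blocked? js)                   ≡⟨ sym (length-map (vertex k) (filter blocked? js)) ⟩
    length (map (vertex k) (filter blocked? js))  ≤⟨ Unique-⊆⇒length-≤ blocked-Unique blocked⊆Bl ⟩
    length Bl                                     ∎)))
  where
  open ≤-Reasoning
  blocked? : Decidable (λ j → vertex k j ∈ Bl)
  blocked? j = vertex k j ∈? Bl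
  weight≤2 : ∀ b → weight b ≤ 2
  weight≤2 true  = ≤-refl
  weight≤2 false = n≤1+n 1
  vertex-injective : ∀ {j j′} → vertex k j ≡ vertex k j′ → j ≡ j′
  vertex-injective refl = refl
  blocked-Unique : Unique (map (vertex k) (filter blocked? js))
  blocked-Unique = Unique.map⁺ vertex-injective (Unique.filter⁺ blocked? u)
  blocked⊆Bl : map (vertex k) (filter blocked? js) ⊆ Bl
  blocked⊆Bl v∈ with ∈-map⁻ (vertex k) v∈
  ... | j , j∈ , refl = proj₂ (∈-filter⁻ blocked? {xs = js} j∈)

blockedUpTo : Strategy → ℕ → List Vertex
blockedUpTo W zero    = []
blockedUpTo W (suc n) = W (suc n) ++ blockedUpTo W n

Blocked⇒∈blockedUpTo : ∀ W n {v} → Blocked W n v → v ∈ blockedUpTo W n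
Blocked⇒∈blockedUpTo W zero    (m , 1≤m , m≤0 , _) = ⊥-elim (1+n≰n (≤-trans 1≤m m≤0))
Blocked⇒∈blockedUpTo W (suc n) (m , 1≤m , m≤1+n , v∈W) with m≤n⇒m<n∨m≡n m≤1+n
... | inj₁ (s≤s m≤n) = ∈-++⁺ʳ (W (suc n)) (Blocked⇒∈blockedUpTo W n (m , 1≤m , m≤n , v∈W))
... | inj₂ refl      = ∈-++⁺ˡ v∈W

length-blockedUpTo : ∀ {f} W → (∀ n → 1 ≤ n → length (W n) ≤ f n) →
                     ∀ n → length (blockedUpTo W n) ≤ partialSum f n
length-blockedUpTo W |W|≤f zero    = z≤n
length-blockedUpTo W |W|≤f (suc n) = ≤-trans (≤-reflexive (length-++ (W (suc n))))
  (+-mono-≤ (|W|≤f (suc n) (s≤s z≤n)) (length-blockedUpTo W |W|≤f n))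

module _ (W : Strategy) (X₀ : List Vertex) where

  Reach⇒¬Blocked : ∀ n {v} → Reach W X₀ n v → ¬ Blocked W n v
  Reach⇒¬Blocked zero    _                    (m , 1≤m , m≤0 , _) = 1+n≰n (≤-trans 1≤m m≤0)
  Reach⇒¬Blocked (suc n) (_ , _ , _ , _ , ¬blocked) = ¬blocked

  Reach⇒¬Blocked-suc : (∀ n v → Reach W X₀ n v → ¬ (v ∈ W (suc n))) →
                       ∀ n {v} → Reach W X₀ n v → ¬ Blocked W (suc n) v
  Reach⇒¬Blocked-suc avoids n r (m , 1≤m , m≤1+n , v∈W) with m≤n⇒m<n∨m≡n m≤1+n
  ... | inj₁ (s≤s m≤n) = Reach⇒¬Blocked n r (m , 1≤m , m≤n , v∈W)
  ... | inj₂ refl      = avoids n _ r v∈W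

  Reach-layer≤ : ∀ {L} → (∀ {v} → v ∈ X₀ → proj₁ v ≤ L) → ∀ n {v} → Reach W X₀ n v → proj₁ v ≤ n + L
  Reach-layer≤ X₀≤L zero    v∈X₀ = X₀≤L v∈X₀
  Reach-layer≤ X₀≤L (suc n) (u , r , inj₁ refl , _) = ≤-trans (Reach-layer≤ X₀≤L n r) (n≤1+n _)
  Reach-layer≤ X₀≤L (suc n) (u , r , inj₂ u~v  , _) =
    ≤-trans (Adj⇒layer≤1+layer u~v) (s≤s (Reach-layer≤ X₀≤L n r))

module Front (M : ℕ) where

  ring : ℕ → ℕ
  ring n = suc (n + M)

  X₀ : List Vertex
  X₀ = map (vertex (ring 0)) (allFin (size (ring 0)))

  X₀-layer≤ : ∀ {v} → v ∈ X₀ → proj₁ v ≤ ring 0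
  X₀-layer≤ v∈ with ∈-map⁻ (vertex (ring 0)) v∈
  ... | _ , _ , refl = ≤-refl

  module _ (W : Strategy) where

    front : (n : ℕ) → List (Fin (size (ring n)))
    front zero    = allFin _
    front (suc n) = unblocked (ring (suc n)) (blockedUpTo W (suc n)) (concatMap (offspring (n + M)) (front n))

    front-Unique : ∀ n → Unique (front n)
    front-Unique zero    = Unique.allFin⁺ _
    front-Unique (suc n) = Unique.filter⁺ _ (concatMap-children-Unique (layer (ring n)) (front-Unique n))

    front-Reach : (∀ n v → Reach W X₀ n v → ¬ (v ∈ W (suc n))) →
                  ∀ n {j} → j ∈ front n → Reach W X₀ n (ring n , j)
    front-Reach avoids zero    {j} _  = ∈-map⁺ (vertex (ring 0)) (∈-allFin j)
    front-Reach avoids (suc n)     j∈ with ∈-filter⁻ _ {xs = concatMap (offspring (n + M)) (front n)} j∈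
    ... | j∈offspring , ¬blocked with ∈-concatMap-children⁻ (layer (ring n)) j∈offspring
    ... | i , i∈ , t , refl =
      (ring n , i) , parent , inj₂ (inj₁ (down (n + M) i _ (suc (toℕ t)) (Finₚ.toℕ<n t) (inj₁ position≡))) ,
      Reach⇒¬Blocked-suc W X₀ avoids n parent , ¬blocked ∘ Blocked⇒∈blockedUpTo W (suc n)
      where
      parent = front-Reach avoids n i∈
      position≡ : suc (toℕ (position (layer (ring n)) i t)) ≡ start (ring n) (toℕ i) + suc (toℕ t)
      position≡ = trans (cong suc (toℕ-position (layer (ring n)) i t)) (sym (+-suc _ _))

    module _ (budget : ∀ n → 4 * length (blockedUpTo W (suc n)) ≤ 2 ^ n * M) where

      potential-front : ∀ n → 2 ^ n * M ≤ potential (ring n) (front n)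
      potential-front zero    = begin
        M + 0                            ≡⟨ +-identityʳ M ⟩
        M                                ≤⟨ n≤1+n M ⟩
        suc M                            ≤⟨ k<size[1+k] M ⟩
        size (ring 0)                    ≡⟨ sym (length-tabulate id) ⟩
        length (front 0)                 ≤⟨ length≤potential (ring 0) (front 0) ⟩
        potential (ring 0) (front 0)     ∎
        where open ≤-Reasoning
      potential-front (suc n) = ≤-trans (≤-reflexive (*-assoc 2 (2 ^ n) M))
        (5c≤2a+4b⇒2c≤a {b = length blocked} (begin
          5 * (2 ^ n * M)                           ≤⟨ *-monoʳ-≤ 5 (potential-front n) ⟩
          5 * potential (ring n) (front n)          ≤⟨ potential-concatMap-offspring (n + M) (front n) ⟩
          2 * Φ candidates                          ≤⟨ *-monoʳ-≤ 2 (potential-unblocked (ring (suc n)) blocked candidates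
                                                         (concatMap-children-Unique (layer (ring n)) (front-Unique n))) ⟩
          2 * (Φ (front (suc n)) + 2 * length blocked)
                                                    ≡⟨ solve 2 (λ a b → con 2 :* (a :+ con 2 :* b) := con 2 :* a :+ con 4 :* b)
                                                             refl (Φ (front (suc n))) (length blocked) ⟩
          2 * Φ (front (suc n)) + 4 * length blocked ∎)
        (budget n))
        where
        open ≤-Reasoning
        Φ = potential (ring (suc n))
        candidates = concatMap (offspring (n + M)) (front n)
        blocked = blockedUpTo W (suc n)

      front-nonempty : 1 ≤ M → ∀ n → ∃ λ j → j ∈ front n
      front-nonempty 1≤M n with front n | potential-front n
      ... | j ∷ _ | _      = j , here refl
      ... | []    | 2ⁿM≤0 = ⊥-elim (1+n≰n (≤-trans (≤-trans 1≤M (m≤n*m M (2 ^ n) {{m^n≢0 2 n}})) 2ⁿM≤0))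

      never-stabilises : (∀ n v → Reach W X₀ n v → ¬ (v ∈ W (suc n))) → 1 ≤ M →
                         ∀ N → ¬ (∀ v → Reach W X₀ (suc N) v → Reach W X₀ N v)
      never-stabilises avoids 1≤M N stable with front-nonempty 1≤M (suc N)
      ... | j , j∈ = 1+n≰n (≤-trans (Reach-layer≤ W X₀ X₀-layer≤ N (stable _ (front-Reach avoids (suc N) j∈)))
                                     (≤-reflexive (+-suc N M)))

4*blockedUpTo≤2^n*[1+8K] : ∀ {f K} W → (∀ n → partialSum f n ≤ K * 2 ^ n) →
                            (∀ n → 1 ≤ n → length (W n) ≤ f n) →
                            ∀ n → 4 * length (blockedUpTo W (suc n)) ≤ 2 ^ n * suc (8 * K)
4*blockedUpTo≤2^n*[1+8K] {f} {K} W S≤K2ⁿ |W|≤f n = begin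
  4 * length (blockedUpTo W (suc n))  ≤⟨ *-monoʳ-≤ 4 (≤-trans (length-blockedUpTo W |W|≤f (suc n))
                                                              (S≤K2ⁿ (suc n))) ⟩
  4 * (K * (2 * p))                   ≡⟨ solve 2 (λ K p → con 4 :* (K :* (con 2 :* p)) := con 8 :* K :* p)
                                                refl K p ⟩
  8 * K * p                           ≤⟨ *-monoˡ-≤ p (n≤1+n (8 * K)) ⟩
  suc (8 * K) * p                     ≡⟨ *-comm (suc (8 * K)) p ⟩
  p * suc (8 * K)                     ∎
  where
  open ≤-Reasoning
  p = 2 ^ n

corollary1p13 : ∀ (d : ℕ) → ¬ HasPolyContainment d
corollary1p13 d (f , f∈O[nᵈ] , contain) =
  let K , S≤K2ⁿ = partialSum-≤-exponential f d f∈O[nᵈ]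
      M = suc (8 * K)
      W , |W|≤f , avoids , N , _ , stable = contain (Front.X₀ M)
  in Front.never-stabilises M W (4*blockedUpTo≤2^n*[1+8K] {K = K} W S≤K2ⁿ |W|≤f) avoids (s≤s z≤n) N
       (λ v → proj₁ (stable (suc N) (n≤1+n N) v))
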